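{- Let $\mathcal{F}$ be a non-principal filter on $\mathbb{N}=\{1,2,3,\dots\}$. Then player TWO does not have a winning strategy in the game $\mathfrak{G}_2(\mathcal{F})$.
   Context: A non-principal filter on $\mathbb{N}$ is a proper filter $\mathcal{F}\subseteq\mathcal{P}(\mathbb{N})$ containing no finite set. The game $\mathfrak{G}_2(\mathcal{F})$: in the $k$-th inning ($k=1,2,\dots$), player ONE chooses $m_k\in\mathbb{N}$ and then player TWO responds with $n_k\in\mathbb{N}$. TWO wins the play $(m_1,n_1,m_2,n_2,\dots)$ if (i) the sequence $(n_k)_k$ eventually dominates $(m_k)_k$, i.e. there is $\ell$ with $m_k<n_k$ for all $k>\ell$, and (ii) $\{n_1,n_2,\dots\}\in\mathcal{F}$; otherwise ONE wins. A strategy for a player assigns a move to each finite sequence of the opponent's previous moves; it is winning if every play following it is won by that player. -}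

module Defs where

open import Level using (0ℓ)
open import Data.Nat using (ℕ; _<_)
open import Data.List using (List; applyUpTo)
open import Data.Product using (Σ; ∃; ∃-syntax; _×_)
open import Data.Empty using (⊥)
open import Relation.Nullary using (¬_)
open import Relation.Unary using (Pred; _⊆_; _∩_; _∈_; _∉_; ∅; U)
open import Relation.Binary.PropositionalEquality using (_≡_)

Subset : Set₁
Subset = Pred ℕ 0ℓ

Finite : Subset → Set
Finite A = ∃[ b ] (∀ n → n ∈ A → n < b)

record IsFilter (F : Pred Subset 0ℓ) : Set₁ where
  field
    whole    : U ∈ F
    proper   : ∅ ∉ F
    upward   : ∀ {A B} → A ∈ F → A ⊆ B → B ∈ F
    meet     : ∀ {A B} → A ∈ F → B ∈ F → (A ∩ B) ∈ F

record IsNonPrincipalFilter (F : Pred Subset 0ℓ) : Set₁ where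
  field
    isFilter  : IsFilter F
    noFinite  : ∀ A → Finite A → A ∉ F

-- A strategy for TWO: maps the finite sequence of ONE's moves so far
-- (m₀, …, m_k) to TWO's response n_k.
StrategyTWO : Set
StrategyTWO = List ℕ → ℕ

responses : StrategyTWO → (ℕ → ℕ) → ℕ → ℕ
responses σ m k = σ (applyUpTo m (Data.Nat.suc k))

range : (ℕ → ℕ) → Subset
range n x = ∃[ k ] (n k ≡ x)

TWOWins : Pred Subset 0ℓ → (ℕ → ℕ) → (ℕ → ℕ) → Set
TWOWins F m n = (∃[ ℓ ] (∀ k → ℓ < k → m k < n k)) × (range n ∈ F)

WinningTWO : Pred Subset 0ℓ → StrategyTWO → Set
WinningTWO F σ = ∀ (m : ℕ → ℕ) → TWOWins F m (responses σ m)

{-# OPTIONS --safe #-}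
-- ONE plays two plays A and B against TWO's strategy at once, each of ONE's
-- moves exceeding every response seen so far in either play:
--   mA 0 = 0,   mB k = mA k + nA k,   mA (k+1) = mB k + nB k.
-- Once TWO dominates in both plays, a response nA i of play A lies strictly
-- below every later response nB j (j ≥ i) of play B, and vice versa, so late
-- responses of A and B never coincide. Hence the two ranges meet in a finite
-- set, although both belong to the filter.
module Submission where

open import Defs
open import Level using (0ℓ)
open import Relation.Unary using (Pred; _∩_; _∈_)
open import Relation.Nullary using (¬_; yes; no)
open import Data.Empty using (⊥-elim)
open import Data.Product using (∃-syntax; _,_)
open import Data.Sum using (inj₁; inj₂)
open import Data.Nat
open import Data.Nat.Properties
open import Data.List using (List; []; _∷ʳ_; applyUpTo)
open import Data.List.Properties using (applyUpTo-∷ʳ)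
open import Relation.Binary.PropositionalEquality

DominatesBeyond : ℕ → (ℕ → ℕ) → (ℕ → ℕ) → Set
DominatesBeyond ℓ m n = ∀ k → ℓ < k → m k < n k

dominatesBeyond-≤ : ∀ {ℓ ℓ′ m n} → ℓ ≤ ℓ′ → DominatesBeyond ℓ m n → DominatesBeyond ℓ′ m n
dominatesBeyond-≤ ℓ≤ℓ′ dom k ℓ′<k = dom k (≤-<-trans ℓ≤ℓ′ ℓ′<k)

mono-≤-from-step : ∀ {f : ℕ → ℕ} → (∀ n → f n ≤ f (suc n)) → ∀ {j k} → j ≤ k → f j ≤ f k
mono-≤-from-step step {k = zero} z≤n = ≤-refl
mono-≤-from-step step {j} {suc k} j≤1+k with m≤n⇒m<n∨m≡n j≤1+k
... | inj₂ refl = ≤-refl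
... | inj₁ j<1+k = ≤-trans (mono-≤-from-step step (s≤s⁻¹ j<1+k)) (step k)

module TwoPlays (σ : StrategyTWO) where

  -- historyA k stands for applyUpTo mA k, which the termination checker
  -- cannot see through; historyA-applyUpTo identifies the two.
  mutual
    historyA historyB : ℕ → List ℕ
    historyA zero = []
    historyA (suc k) = historyA k ∷ʳ mA k
    historyB zero = []
    historyB (suc k) = historyB k ∷ʳ mB k

    mA mB : ℕ → ℕ
    mA zero = 0
    mA (suc k) = mB k + σ (historyB k ∷ʳ mB k)
    mB k = mA k + σ (historyA k ∷ʳ mA k)

  nA nB : ℕ → ℕ
  nA = responses σ mA
  nB = responses σ mB

  historyA-applyUpTo : ∀ k → historyA k ≡ applyUpTo mA k
  historyA-applyUpTo zero = refl
  historyA-applyUpTo (suc k) =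
    trans (cong (_∷ʳ mA k) (historyA-applyUpTo k)) (applyUpTo-∷ʳ mA k)

  historyB-applyUpTo : ∀ k → historyB k ≡ applyUpTo mB k
  historyB-applyUpTo zero = refl
  historyB-applyUpTo (suc k) =
    trans (cong (_∷ʳ mB k) (historyB-applyUpTo k)) (applyUpTo-∷ʳ mB k)

  mB≡mA+nA : ∀ k → mB k ≡ mA k + nA k
  mB≡mA+nA k = cong (λ h → mA k + σ h) (historyA-applyUpTo (suc k))

  mA-suc≡mB+nB : ∀ k → mA (suc k) ≡ mB k + nB k
  mA-suc≡mB+nB k = cong (λ h → mB k + σ h) (historyB-applyUpTo (suc k))

  mA≤mB : ∀ k → mA k ≤ mB k
  mA≤mB k = ≤-trans (m≤m+n (mA k) (nA k)) (≤-reflexive (sym (mB≡mA+nA k)))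

  nA≤mB : ∀ k → nA k ≤ mB k
  nA≤mB k = ≤-trans (m≤n+m (nA k) (mA k)) (≤-reflexive (sym (mB≡mA+nA k)))

  mB≤mA-suc : ∀ k → mB k ≤ mA (suc k)
  mB≤mA-suc k = ≤-trans (m≤m+n (mB k) (nB k)) (≤-reflexive (sym (mA-suc≡mB+nB k)))

  nB≤mA-suc : ∀ k → nB k ≤ mA (suc k)
  nB≤mA-suc k = ≤-trans (m≤n+m (nB k) (mB k)) (≤-reflexive (sym (mA-suc≡mB+nB k)))

  mA-mono : ∀ {j k} → j ≤ k → mA j ≤ mA k
  mA-mono = mono-≤-from-step (λ k → ≤-trans (mA≤mB k) (mB≤mA-suc k))

  mB-mono : ∀ {j k} → j ≤ k → mB j ≤ mB k
  mB-mono = mono-≤-from-step (λ k → ≤-trans (mB≤mA-suc k) (mA≤mB (suc k)))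

  nA≤mA-suc : ∀ k → nA k ≤ mA (suc k)
  nA≤mA-suc k = ≤-trans (nA≤mB k) (mB≤mA-suc k)

  nA<nB : ∀ {i j} → i ≤ j → mB j < nB j → nA i < nB j
  nA<nB {i} {j} i≤j = ≤-<-trans (≤-trans (nA≤mB i) (mB-mono i≤j))

  nB<nA : ∀ {i j} → j < i → mA i < nA i → nB j < nA i
  nB<nA {i} {j} j<i = ≤-<-trans (≤-trans (nB≤mA-suc j) (mA-mono j<i))

  lateResponses-differ : ∀ {ℓ i j} → DominatesBeyond ℓ mA nA → DominatesBeyond ℓ mB nB →
                         ℓ < i → ℓ < j → nA i ≢ nB j
  lateResponses-differ {i = i} {j} domA domB ℓ<i ℓ<j nAi≡nBj with i ≤? j
  ... | yes i≤j = <-irrefl nAi≡nBj (nA<nB i≤j (domB j ℓ<j))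
  ... | no i≰j = <-irrefl (sym nAi≡nBj) (nB<nA (≰⇒> i≰j) (domA i ℓ<i))

  commonResponse≤ : ∀ {ℓ i j} → DominatesBeyond ℓ mA nA → DominatesBeyond ℓ mB nB →
                    nA i ≡ nB j → nA i ≤ mA (suc ℓ)
  commonResponse≤ {ℓ} {i} {j} domA domB nAi≡nBj with i ≤? ℓ | j ≤? ℓ
  ... | yes i≤ℓ | _ = ≤-trans (nA≤mA-suc i) (mA-mono (s≤s i≤ℓ))
  ... | no _ | yes j≤ℓ = subst (_≤ mA (suc ℓ)) (sym nAi≡nBj) (≤-trans (nB≤mA-suc j) (mA-mono (s≤s j≤ℓ)))
  ... | no i≰ℓ | no j≰ℓ = ⊥-elim (lateResponses-differ domA domB (≰⇒> i≰ℓ) (≰⇒> j≰ℓ) nAi≡nBj)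

  commonRange-finite : ∀ {ℓA ℓB} → DominatesBeyond ℓA mA nA → DominatesBeyond ℓB mB nB →
                       Finite (range nA ∩ range nB)
  commonRange-finite {ℓA} {ℓB} domA domB = suc (mA (suc ℓ)) , bound
    where
    ℓ : ℕ
    ℓ = ℓA ⊔ ℓB

    bound : ∀ x → x ∈ range nA ∩ range nB → x < suc (mA (suc ℓ))
    bound x ((i , refl) , (j , nBj≡nAi)) =
      s≤s (commonResponse≤ (dominatesBeyond-≤ (m≤m⊔n ℓA ℓB) domA)
                           (dominatesBeyond-≤ (m≤n⊔m ℓA ℓB) domB) (sym nBj≡nAi))

mainTheorem3 : (F : Pred Subset 0ℓ) → IsNonPrincipalFilter F →
    ¬ (∃[ σ ] WinningTWO F σ)
mainTheorem3 _ npf (σ , win) =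
  let open TwoPlays σ
      ((_ , domA) , rangeA∈F) = win mA
      ((_ , domB) , rangeB∈F) = win mB
  in noFinite _ (commonRange-finite domA domB) (meet rangeA∈F rangeB∈F)
  where open IsNonPrincipalFilter npf
        open IsFilter isFilter
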